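{- Every problem accepted by a program scheme of $\mathrm{NPSA}(1)$ is closed under extensions: if $\rho\in\mathrm{NPSA}(1)$ is over $\sigma$, $\mathcal A,\mathcal B$ are $\sigma$-structures with $\mathcal A\subseteq\mathcal B$, and $\mathcal A$ is accepted by $\rho$, then $\mathcal B$ is accepted by $\rho$.
   Context: All structures are finite with at least two elements. For $\sigma$-structures $\mathcal A,\mathcal B$, $\mathcal A\subseteq\mathcal B$ means $|\mathcal A|\subseteq|\mathcal B|$, each relation of $\mathcal A$ is the restriction of the corresponding relation of $\mathcal B$ to $|\mathcal A|$, and constants agree. Program schemes of $\mathrm{NPSA}(1)$ over $\sigma$ (here without free variables): variables $x_1,\dots,x_k$ and array symbols of given dimensions; instructions $\mathtt{input}(x_1,\dots,x_k)$ first and $\mathtt{output}(x_1,\dots,x_k)$ last, others assignments $x_i:=y$, $x_i:=A[y_1,\dots,y_d]$, $A[y_1,\dots,y_d]:=y_0$ ($y_j$ variables, constant symbols of $\sigma$, or special constants $0,max$), guesses $\mathtt{guess}\ x_i$, and while instructions $\mathtt{while}\ \varphi\ \mathtt{do}\dots\mathtt{od}$ with $\varphi$ quantifier-free first-order over $\sigma\cup\{0,max\}$. On input a $\sigma$-structure, $0$ and $max$ denote two arbitrary distinct elements; all variables and array elements start with value $0$; a guess assigns any element nondeterministically; the input is accepted iff some computation reaches the output instruction with all variables equal to $max$. Only schemes whose acceptance is independent of the choice of distinct $0,max$ are admitted. -}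

module Defs where

open import Data.Nat using (ℕ; _≤_)
open import Data.Fin using (Fin)
open import Data.Vec using (Vec; map)
open import Data.List using (List)
import Data.List as List
open import Data.Product using (Σ; _×_; ∃)
open import Data.Sum using (_⊎_)
open import Relation.Nullary using (¬_)
open import Relation.Binary.PropositionalEquality using (_≡_; _≢_)
open import Function.Bundles using (_↔_; _⇔_)
open import Function.Definitions using (Injective)
open import Level using () renaming (suc to lsuc; zero to lzero)

record Sig : Set where
  field
    nRel   : ℕ
    arity  : Fin nRel → ℕ
    nConst : ℕ
open Sig public

record Structure (σ : Sig) : Set₁ where
  field
    Carrier : Set
    size    : ℕ
    enum    : Carrier ↔ Fin size
    two≤    : 2 ≤ size
    rel     : (r : Fin (nRel σ)) → Vec Carrier (arity σ r) → Set
    const   : Fin (nConst σ) → Carrier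
open Structure public

-- A ⊆ B: A is (an isomorphic copy of) an induced substructure of B,
-- given by an injective map of the universes which preserves and
-- reflects all relations and preserves all constants.
record _⊆_ {σ : Sig} (A B : Structure σ) : Set where
  field
    emb       : Carrier A → Carrier B
    emb-inj   : Injective _≡_ _≡_ emb
    emb-rel   : (r : Fin (nRel σ)) (v : Vec (Carrier A) (arity σ r)) →
                rel A r v ⇔ rel B r (map emb v)
    emb-const : (c : Fin (nConst σ)) → emb (const A c) ≡ const B c

module Syntax (σ : Sig) (k nArr : ℕ) (dims : Fin nArr → ℕ) where

  data Term : Set where
    var  : Fin k → Term
    cst  : Fin (nConst σ) → Term
    zero : Term
    max  : Term

  data Formula : Set where
    atom : (r : Fin (nRel σ)) → Vec Term (arity σ r) → Formula
    eq   : Term → Term → Formula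
    neg  : Formula → Formula
    and  : Formula → Formula → Formula
    or   : Formula → Formula → Formula

  data Instr : Set where
    assign : Fin k → Term → Instr
    read   : Fin k → (a : Fin nArr) → Vec Term (dims a) → Instr
    write  : (a : Fin nArr) → Vec Term (dims a) → Term → Instr
    guess  : Fin k → Instr
    while  : Formula → List Instr → Instr

-- A program scheme: input(x_1..x_k); body; output(x_1..x_k).
record Program (σ : Sig) : Set where
  field
    k    : ℕ
    nArr : ℕ
    dims : Fin nArr → ℕ
  field
    body : List (Syntax.Instr σ k nArr dims)
open Program public

module Semantics {σ : Sig} (ρ : Program σ) (A : Structure σ)
                 (z m : Carrier A) where
  open Syntax σ (k ρ) (nArr ρ) (dims ρ)
  D = Carrier A

  record State : Set where
    constructor ⟨_,_⟩
    field
      vars : Fin (k ρ) → D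
      arr  : (a : Fin (nArr ρ)) → Vec D (dims ρ a) → D
  open State public

  evalT : State → Term → D
  evalT s (var i) = vars s i
  evalT s (cst c) = const A c
  evalT s zero    = z
  evalT s max     = m

  Holds : State → Formula → Set
  Holds s (atom r ts) = rel A r (map (evalT s) ts)
  Holds s (eq t u)    = evalT s t ≡ evalT s u
  Holds s (neg φ)     = ¬ Holds s φ
  Holds s (and φ ψ)   = Holds s φ × Holds s ψ
  Holds s (or φ ψ)    = Holds s φ ⊎ Holds s ψ

  SetVar : Fin (k ρ) → D → State → State → Set
  SetVar i d s s' =
    (vars s' i ≡ d) ×
    ((j : Fin (k ρ)) → j ≢ i → vars s' j ≡ vars s j) ×
    ((a : Fin (nArr ρ)) (v : Vec D (dims ρ a)) → arr s' a v ≡ arr s a v)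

  SetArr : (a : Fin (nArr ρ)) → Vec D (dims ρ a) → D → State → State → Set
  SetArr a v d s s' =
    ((j : Fin (k ρ)) → vars s' j ≡ vars s j) ×
    (arr s' a v ≡ d) ×
    ((w : Vec D (dims ρ a)) → w ≢ v → arr s' a w ≡ arr s a w) ×
    ((b : Fin (nArr ρ)) → b ≢ a →
       (w : Vec D (dims ρ b)) → arr s' b w ≡ arr s b w)

  data Exec : List Instr → State → State → Set
  data ExecI : Instr → State → State → Set

  data Exec where
    []  : ∀ {s} → Exec List.[] s s
    _∷_ : ∀ {i is s s₁ s₂} → ExecI i s s₁ → Exec is s₁ s₂ →
          Exec (i List.∷ is) s s₂

  data ExecI where
    assignE : ∀ {i t s s'} → SetVar i (evalT s t) s s' →
              ExecI (assign i t) s s'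
    readE   : ∀ {i a ts s s'} →
              SetVar i (arr s a (map (evalT s) ts)) s s' →
              ExecI (read i a ts) s s'
    writeE  : ∀ {a ts t s s'} →
              SetArr a (map (evalT s) ts) (evalT s t) s s' →
              ExecI (write a ts t) s s'
    guessE  : ∀ {i s s'} (d : D) → SetVar i d s s' →
              ExecI (guess i) s s'
    whileF  : ∀ {φ b s} → ¬ Holds s φ → ExecI (while φ b) s s
    whileT  : ∀ {φ b s s₁ s₂} → Holds s φ → Exec b s s₁ →
              ExecI (while φ b) s₁ s₂ → ExecI (while φ b) s s₂

  Initial : State → Set
  Initial s = ((i : Fin (k ρ)) → vars s i ≡ z) ×
              ((a : Fin (nArr ρ)) (v : Vec D (dims ρ a)) → arr s a v ≡ z)

  AcceptsWith : Set
  AcceptsWith = Σ State λ s₀ → Σ State λ s₁ →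
                Initial s₀ × Exec (body ρ) s₀ s₁ ×
                ((i : Fin (k ρ)) → vars s₁ i ≡ m)


AcceptsWith : ∀ {σ} → Program σ → (A : Structure σ) → Carrier A → Carrier A → Set
AcceptsWith ρ A z m = Semantics.AcceptsWith ρ A z m

-- ρ admitted to NPSA(1): acceptance independent of the choice of distinct 0, max
Admissible : ∀ {σ} → Program σ → Set₁
Admissible {σ} ρ = (A : Structure σ) (z m z' m' : Carrier A) →
  z ≢ m → z' ≢ m' → AcceptsWith ρ A z m → AcceptsWith ρ A z' m'

-- A is accepted by ρ (for some, equivalently every, choice of distinct 0, max)
Accepts : ∀ {σ} → Program σ → Structure σ → Set
Accepts ρ A = Σ (Carrier A) λ z → Σ (Carrier A) λ m → z ≢ m × AcceptsWith ρ A z m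

{-# OPTIONS --safe #-}
module Submission where

-- An accepting computation on A is replayed step by step on B, with 0 and
-- max interpreted as the images of their values on A and every guess
-- replaced by the image of the guessed element. Throughout the replay each
-- variable, and each array cell indexed by images of elements of A, holds
-- the image of its value on A; since all terms evaluate into that image,
-- no other cell is ever read. Tests give the same answers on both sides
-- because the embedding is injective and preserves and reflects relations
-- and constants.

open import Defs
open import Data.Fin using (Fin) renaming (_≟_ to _≟ᶠ_)
open import Data.Vec using (Vec; []; _∷_; map)
open import Data.Vec.Properties using (∷-injective; map-cong; map-∘)
  renaming (≡-dec to Vec-≡-dec)
open import Data.Product using (Σ; _×_; _,_)
open import Data.Product.Function.NonDependent.Propositional using (_×-⇔_)
open import Data.Sum.Function.Propositional using (_⊎-⇔_)
open import Function using (_∘_)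
open import Function.Bundles using (_⇔_; mk⇔; Equivalence)
open import Function.Definitions using (Injective)
open import Function.Properties.Inverse using (↔⇒↣)
open import Function.Related.TypeIsomorphisms using (¬-cong-⇔)
open import Relation.Binary.Definitions using (DecidableEquality)
open import Relation.Binary.PropositionalEquality
open import Relation.Nullary using (yes; no; contradiction)
open import Relation.Nullary.Decidable using (via-injection)

map-injective : ∀ {X Y : Set} {f : X → Y} {n} →
                Injective _≡_ _≡_ f → Injective _≡_ _≡_ (map {n = n} f)
map-injective f-inj {[]}    {[]}    _  = refl
map-injective f-inj {x ∷ u} {y ∷ v} eq with ∷-injective eq
... | fx≡fy , fu≡fv = cong₂ _∷_ (f-inj fx≡fy) (map-injective f-inj fu≡fv)

Carrier-≟ : ∀ {σ} (A : Structure σ) → DecidableEquality (Carrier A)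
Carrier-≟ A = via-injection (↔⇒↣ (enum A)) _≟ᶠ_

module _ {X : Set} {P : X → Set} (_≟_ : DecidableEquality X) where

  update : ((x : X) → P x) → (x : X) → P x → (x : X) → P x
  update f x y x′ with x′ ≟ x
  ... | yes refl = y
  ... | no _     = f x′

  update-updates : ∀ f x y → update f x y x ≡ y
  update-updates f x y with x ≟ x
  ... | yes refl = refl
  ... | no x≢x   = contradiction refl x≢x

  update-minimal : ∀ f {x x′} y → x′ ≢ x → update f x y x′ ≡ f x′
  update-minimal f {x} {x′} y x′≢x with x′ ≟ x
  ... | yes x′≡x = contradiction x′≡x x′≢x
  ... | no _     = refl

module StateUpdate {σ : Sig} (ρ : Program σ) (A : Structure σ) (z m : Carrier A) where
  open Semantics ρ A z m

  private
    _≟ᵛ_ : ∀ {n} → DecidableEquality (Vec D n)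
    _≟ᵛ_ = Vec-≡-dec (Carrier-≟ A)

  setVar : State → Fin (k ρ) → D → State
  setVar s i d = ⟨ update _≟ᶠ_ (vars s) i d , arr s ⟩

  setArr : State → (a : Fin (nArr ρ)) → Vec D (dims ρ a) → D → State
  setArr s a v d = ⟨ vars s , update _≟ᶠ_ (arr s) a (update _≟ᵛ_ (arr s a) v d) ⟩

  SetVar-setVar : ∀ s i d → SetVar i d s (setVar s i d)
  SetVar-setVar s i d =
      update-updates _≟ᶠ_ (vars s) i d
    , (λ _ → update-minimal _≟ᶠ_ (vars s) d)
    , (λ _ _ → refl)

  SetArr-setArr : ∀ s a v d → SetArr a v d s (setArr s a v d)
  SetArr-setArr s a v d =
      (λ _ → refl)
    , trans (row v) (update-updates _≟ᵛ_ (arr s a) v d)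
    , (λ w w≢v → trans (row w) (update-minimal _≟ᵛ_ (arr s a) d w≢v))
    , (λ b b≢a → cong-app (update-minimal _≟ᶠ_ (arr s) _ b≢a))
    where
    row : ∀ w → arr (setArr s a v d) a w ≡ update _≟ᵛ_ (arr s a) v d w
    row = cong-app (update-updates _≟ᶠ_ (arr s) a _)

module Simulation {σ : Sig} (ρ : Program σ) (A B : Structure σ) (A⊆B : A ⊆ B)
                  (z m : Carrier A) where
  open _⊆_ A⊆B
  open Syntax σ (k ρ) (nArr ρ) (dims ρ)
  module SA = Semantics ρ A z m
  module SB = Semantics ρ B (emb z) (emb m)
  open StateUpdate ρ B (emb z) (emb m)

  record _∼_ (sA : SA.State) (sB : SB.State) : Set where
    field
      vars-∼ : SB.vars sB ≗ emb ∘ SA.vars sA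
      arr-∼  : ∀ a v → SB.arr sB a (map emb v) ≡ emb (SA.arr sA a v)
  open _∼_

  initial : SB.State
  initial = SB.⟨ (λ _ → emb z) , (λ _ _ → emb z) ⟩

  Initial-∼ : ∀ {sA} → SA.Initial sA → sA ∼ initial
  Initial-∼ (vars-z , arr-z) = record
    { vars-∼ = λ i → cong emb (sym (vars-z i))
    ; arr-∼  = λ a v → cong emb (sym (arr-z a v))
    }

  module _ {sA sB} (sA∼sB : sA ∼ sB) where

    evalT-∼ : SB.evalT sB ≗ emb ∘ SA.evalT sA
    evalT-∼ (var i) = vars-∼ sA∼sB i
    evalT-∼ (cst c) = sym (emb-const c)
    evalT-∼ zero    = refl
    evalT-∼ max     = refl

    map-evalT-∼ : ∀ {n} (ts : Vec Term n) →
                  map (SB.evalT sB) ts ≡ map emb (map (SA.evalT sA) ts)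
    map-evalT-∼ ts = trans (map-cong evalT-∼ ts) (map-∘ emb (SA.evalT sA) ts)

    Holds-∼ : ∀ φ → SA.Holds sA φ ⇔ SB.Holds sB φ
    Holds-∼ (atom r ts) rewrite map-evalT-∼ ts        = emb-rel r _
    Holds-∼ (eq t u)    rewrite evalT-∼ t | evalT-∼ u = mk⇔ (cong emb) emb-inj
    Holds-∼ (neg φ)     = ¬-cong-⇔ (Holds-∼ φ)
    Holds-∼ (and φ ψ)   = Holds-∼ φ ×-⇔ Holds-∼ ψ
    Holds-∼ (or φ ψ)    = Holds-∼ φ ⊎-⇔ Holds-∼ ψ

    setVar-∼ : ∀ {sA′ sB′ i d d′} →
               SA.SetVar i d sA sA′ → SB.SetVar i d′ sB sB′ →
               d′ ≡ emb d → sA′ ∼ sB′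
    setVar-∼ {sA′} {sB′} {i} (atA , offA , arrsA) (atB , offB , arrsB) refl = record
      { vars-∼ = vars′-∼
      ; arr-∼  = λ a v → begin
          SB.arr sB′ a (map emb v) ≡⟨ arrsB a _ ⟩
          SB.arr sB a (map emb v)  ≡⟨ arr-∼ sA∼sB a v ⟩
          emb (SA.arr sA a v)      ≡⟨ cong emb (arrsA a v) ⟨
          emb (SA.arr sA′ a v)     ∎
      }
      where
      open ≡-Reasoning
      vars′-∼ : SB.vars sB′ ≗ emb ∘ SA.vars sA′
      vars′-∼ j with j ≟ᶠ i
      ... | yes refl = trans atB (cong emb (sym atA))
      ... | no j≢i   = begin
        SB.vars sB′ j       ≡⟨ offB j j≢i ⟩
        SB.vars sB j        ≡⟨ vars-∼ sA∼sB j ⟩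
        emb (SA.vars sA j)  ≡⟨ cong emb (offA j j≢i) ⟨
        emb (SA.vars sA′ j) ∎

    setArr-∼ : ∀ {sA′ sB′ a v v′ d d′} →
               SA.SetArr a v d sA sA′ → SB.SetArr a v′ d′ sB sB′ →
               v′ ≡ map emb v → d′ ≡ emb d → sA′ ∼ sB′
    setArr-∼ {sA′} {sB′} {a} {v}
             (varsA , atA , off-vA , off-aA) (varsB , atB , off-vB , off-aB) refl refl = record
      { vars-∼ = λ j → trans (varsB j) (trans (vars-∼ sA∼sB j) (cong emb (sym (varsA j))))
      ; arr-∼  = arr′-∼
      }
      where
      open ≡-Reasoning
      arr′-∼ : ∀ b w → SB.arr sB′ b (map emb w) ≡ emb (SA.arr sA′ b w)
      arr′-∼ b w with b ≟ᶠ a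
      ... | no b≢a = begin
        SB.arr sB′ b (map emb w) ≡⟨ off-aB b b≢a _ ⟩
        SB.arr sB b (map emb w)  ≡⟨ arr-∼ sA∼sB b w ⟩
        emb (SA.arr sA b w)      ≡⟨ cong emb (off-aA b b≢a w) ⟨
        emb (SA.arr sA′ b w)     ∎
      ... | yes refl with Vec-≡-dec (Carrier-≟ A) w v
      ...   | yes refl = trans atB (cong emb (sym atA))
      ...   | no w≢v   = begin
        SB.arr sB′ a (map emb w) ≡⟨ off-vB _ (w≢v ∘ map-injective emb-inj) ⟩
        SB.arr sB a (map emb w)  ≡⟨ arr-∼ sA∼sB a w ⟩
        emb (SA.arr sA a w)      ≡⟨ cong emb (off-vA w w≢v) ⟨
        emb (SA.arr sA′ a w)     ∎

  Exec-∼ : ∀ {is sA sA′ sB} → SA.Exec is sA sA′ → sA ∼ sB →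
           Σ SB.State λ sB′ → SB.Exec is sB sB′ × sA′ ∼ sB′
  ExecI-∼ : ∀ {i sA sA′ sB} → SA.ExecI i sA sA′ → sA ∼ sB →
            Σ SB.State λ sB′ → SB.ExecI i sB sB′ × sA′ ∼ sB′

  Exec-∼ SA.[] sA∼sB = _ , SB.[] , sA∼sB
  Exec-∼ (step SA.∷ steps) sA∼sB with ExecI-∼ step sA∼sB
  ... | _ , stepB , ∼₁ with Exec-∼ steps ∼₁
  ...   | _ , stepsB , ∼₂ = _ , stepB SB.∷ stepsB , ∼₂

  ExecI-∼ {sB = sB} (SA.assignE {i = i} {t} upd) sA∼sB =
    _ , SB.assignE set , setVar-∼ sA∼sB upd set (evalT-∼ sA∼sB t)
    where set = SetVar-setVar sB i (SB.evalT sB t)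
  ExecI-∼ {sB = sB} (SA.readE {i = i} {a} {ts} upd) sA∼sB =
    _ , SB.readE set , setVar-∼ sA∼sB upd set
      (trans (cong (SB.arr sB a) (map-evalT-∼ sA∼sB ts)) (arr-∼ sA∼sB a _))
    where set = SetVar-setVar sB i (SB.arr sB a (map (SB.evalT sB) ts))
  ExecI-∼ {sB = sB} (SA.writeE {a = a} {ts} {t} upd) sA∼sB =
    _ , SB.writeE set ,
    setArr-∼ sA∼sB upd set (map-evalT-∼ sA∼sB ts) (evalT-∼ sA∼sB t)
    where set = SetArr-setArr sB a (map (SB.evalT sB) ts) (SB.evalT sB t)
  ExecI-∼ {sB = sB} (SA.guessE {i = i} d upd) sA∼sB =
    _ , SB.guessE (emb d) set , setVar-∼ sA∼sB upd set refl
    where set = SetVar-setVar sB i (emb d)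
  ExecI-∼ (SA.whileF {φ = φ} ¬φ) sA∼sB =
    _ , SB.whileF (¬φ ∘ Equivalence.from (Holds-∼ sA∼sB φ)) , sA∼sB
  ExecI-∼ (SA.whileT {φ = φ} φ-holds body loop) sA∼sB with Exec-∼ body sA∼sB
  ... | _ , bodyB , ∼₁ with ExecI-∼ loop ∼₁
  ...   | _ , loopB , ∼₂ =
    _ , SB.whileT (Equivalence.to (Holds-∼ sA∼sB φ) φ-holds) bodyB loopB , ∼₂

  AcceptsWith-⊆ : AcceptsWith ρ A z m → AcceptsWith ρ B (emb z) (emb m)
  AcceptsWith-⊆ (_ , _ , init , run , accept) with Exec-∼ run (Initial-∼ init)
  ... | sB₁ , runB , ∼₁ =
    initial , sB₁ , ((λ _ → refl) , (λ _ _ → refl)) , runB ,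
    (λ i → trans (vars-∼ ∼₁ i) (cong emb (accept i)))

lemma13 : (σ : Sig) (ρ : Program σ) → Admissible ρ →
            (A B : Structure σ) → A ⊆ B → Accepts ρ A → Accepts ρ B
lemma13 σ ρ _ A B A⊆B (z , m , z≢m , accepted) =
  emb z , emb m , z≢m ∘ emb-inj , Simulation.AcceptsWith-⊆ ρ A B A⊆B z m accepted
  where open _⊆_ A⊆B
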